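{- For every integer $t \geq 1$, $$s_{3,t}(m) \ll s_{3,t+1}(m+1) \ll m\, s_{3,t}(m).$$
   Context: All graphs are finite and simple. A $(3,t)$-system is a pair $(H,\mathcal{F})$ where $H$ is a triangle-free graph and $\mathcal{F}$ is a family (without repeated elements) of subsets of $V(H)$, each of size exactly $t$, such that every $S\in\mathcal{F}$ is a maximal independent set of $H$ (independent, and every vertex outside $S$ has a neighbour in $S$), and any two distinct sets in $\mathcal{F}$ intersect. For integers $t\ge1$, $m\ge0$, $s_{3,t}(m)$ is the maximum of $|\mathcal{F}|$ over all $(3,t)$-systems $(H,\mathcal{F})$ with $|V(H)|=m$. $f\ll g$ means $f=O(g)$ as $m\to\infty$ with $t$ fixed (constants may depend on $t$). -}

module Defs where

open import Data.Nat using (ℕ; suc; _*_; _≤_)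
open import Data.Bool using (Bool; true; false)
open import Data.Fin using (Fin)
open import Data.Fin.Subset using (Subset; _∈_; _∉_; ∣_∣)
open import Data.List using (List; length)
open import Data.List.Relation.Unary.Unique.Propositional using (Unique)
import Data.List.Membership.Propositional as LM
open import Data.Product using (Σ; ∃; _×_)
open import Relation.Binary.PropositionalEquality using (_≡_; _≢_)
open import Relation.Nullary using (¬_)

record Graph (m : ℕ) : Set where
  field
    adj     : Fin m → Fin m → Bool
    symm    : ∀ x y → adj x y ≡ adj y x
    irrefl  : ∀ x → adj x x ≡ false

open Graph public

Adj : ∀ {m} → Graph m → Fin m → Fin m → Set
Adj H x y = adj H x y ≡ true

TriangleFree : ∀ {m} → Graph m → Set
TriangleFree H = ∀ x y z → ¬ (Adj H x y × Adj H y z × Adj H x z)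

Independent : ∀ {m} → Graph m → Subset m → Set
Independent H S = ∀ x y → x ∈ S → y ∈ S → ¬ Adj H x y

MaximalIndependent : ∀ {m} → Graph m → Subset m → Set
MaximalIndependent H S =
  Independent H S × (∀ v → v ∉ S → ∃ λ u → u ∈ S × Adj H v u)

record System (t m : ℕ) : Set where
  field
    H        : Graph m
    triFree  : TriangleFree H
    F        : List (Subset m)
    noRep    : Unique F
    size     : ∀ S → S LM.∈ F → ∣ S ∣ ≡ t
    maxInd   : ∀ S → S LM.∈ F → MaximalIndependent H S
    intersecting : ∀ S T → S LM.∈ F → T LM.∈ F → S ≢ T →
                   ∃ λ x → x ∈ S × x ∈ T

-- k = s_{3,t}(m): k is attained by some (3,t)-system on m vertices, and
-- every (3,t)-system on m vertices has |F| ≤ k.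
IsS3 : ℕ → ℕ → ℕ → Set
IsS3 t m k =
  (Σ (System t m) λ sys → length (System.F sys) ≡ k) ×
  (∀ (sys : System t m) → length (System.F sys) ≤ k)

{-# OPTIONS --safe #-}
-- Adding an isolated vertex to H and to every set of the family maps (3,t)-systems on m
-- vertices injectively to (3,t+1)-systems on m+1 vertices.  Conversely, fix a member S₀ of a
-- (3,t+1)-system (H, F) on m+1 vertices.  Every member meets S₀ and, as t ≥ 1, contains a
-- second vertex besides any given one, so |F| ≤ Σ_{x∈S₀} Σ_{u≠x} |F_{x,u}|, where F_{x,u}
-- consists of the members containing x and u.  Deleting x, removing every edge at a former
-- neighbour of x and joining those neighbours to u instead keeps the graph triangle-free
-- (all new edges end in u) and turns {S - x : S ∈ F_{x,u}} into a (3,t)-system on m vertices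
-- (u dominates the former neighbours of x, and every set contains u).  Hence
-- |F_{x,u}| ≤ s_{3,t}(m), and s_{3,t+1}(m+1) ≤ (t+1) m s_{3,t}(m).

module Submission where

open import Defs
open import Data.Nat using (ℕ; zero; suc; _+_; _*_; _≤_; z≤n)
open import Data.Nat.Properties
  using (≤-reflexive; ≤-trans; m≤m+n; m≤n+m; +-mono-≤; *-identityˡ; suc-injective
        ; +-commutativeSemigroup; module ≤-Reasoning)
open import Algebra.Properties.CommutativeSemigroup +-commutativeSemigroup using (interchange)
open import Data.Bool using (Bool; true; false)
open import Data.Bool.Properties using (¬-not)
import Data.Bool as Bool
open import Data.Fin using (Fin; zero; suc; punchIn; punchOut; _≟_)
open import Data.Fin.Properties using (punchIn-punchOut)
open import Data.Fin.Subset using (Subset; inside; outside; _∈_; _∉_; ∣_∣; ⊤; Nonempty)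
open import Data.Fin.Subset.Properties using (_∈?_; ∈⊤; ∣⊤∣≡n)
open import Data.Vec using (Vec; []; _∷_; here; there; lookup; removeAt; insertAt)
open import Data.Vec.Properties
  using (∷-injectiveʳ; []=⇒lookup; lookup⇒[]=; insertAt-punchIn; insertAt-removeAt; ≡-dec)
open import Data.List using (List; []; _∷_; [_]; length; filter; map)
open import Data.List.Properties using (filter-some; length-++; filter-++; length-map; map-∘; map-id-local)
import Data.List.Membership.Propositional as List
open import Data.List.Membership.Propositional.Properties using (∈-map⁻; ∈-filter⁻)
open import Data.List.Relation.Unary.Any using (here; there)
open import Data.List.Relation.Unary.All as All using (All)
open import Data.List.Relation.Unary.Unique.Propositional using (Unique)
import Data.List.Relation.Unary.Unique.Propositional.Properties as Unique
open import Data.Product using (∃; _×_; _,_; proj₁; proj₂)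
open import Data.Sum using (_⊎_; inj₁; inj₂)
open import Data.Empty using (⊥-elim)
open import Function using (_∘_)
open import Relation.Binary.PropositionalEquality
  using (_≡_; _≢_; refl; sym; trans; cong; cong₂; subst; module ≡-Reasoning)
open import Relation.Nullary using (¬_; does; yes; no)
open import Relation.Nullary.Decidable using (dec-true)
open import Relation.Unary using (Decidable)

private variable
  t m n : ℕ

sumOver : Subset n → (Fin n → ℕ) → ℕ
sumOver []            f = 0
sumOver (outside ∷ S) f = sumOver S (f ∘ suc)
sumOver (inside  ∷ S) f = f zero + sumOver S (f ∘ suc)

sumOver-cong : ∀ (S : Subset n) {f g} → (∀ i → f i ≡ g i) → sumOver S f ≡ sumOver S g
sumOver-cong []            f≗g = refl
sumOver-cong (outside ∷ S) f≗g = sumOver-cong S (f≗g ∘ suc)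
sumOver-cong (inside  ∷ S) f≗g = cong₂ _+_ (f≗g zero) (sumOver-cong S (f≗g ∘ suc))

sumOver-+ : ∀ (S : Subset n) f g → sumOver S (λ i → f i + g i) ≡ sumOver S f + sumOver S g
sumOver-+ []            f g = refl
sumOver-+ (outside ∷ S) f g = sumOver-+ S (f ∘ suc) (g ∘ suc)
sumOver-+ (inside  ∷ S) f g = begin
  f zero + g zero + sumOver S (λ i → f (suc i) + g (suc i))
    ≡⟨ cong (f zero + g zero +_) (sumOver-+ S (f ∘ suc) (g ∘ suc)) ⟩
  f zero + g zero + (sumOver S (f ∘ suc) + sumOver S (g ∘ suc))
    ≡⟨ interchange (f zero) (g zero) _ _ ⟩
  f zero + sumOver S (f ∘ suc) + (g zero + sumOver S (g ∘ suc))
    ∎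
  where open ≡-Reasoning

≤-sumOver : ∀ {S : Subset n} {i} f → i ∈ S → f i ≤ sumOver S f
≤-sumOver {S = inside  ∷ S} f here        = m≤m+n _ _
≤-sumOver {S = outside ∷ S} f (there i∈S) = ≤-sumOver (f ∘ suc) i∈S
≤-sumOver {S = inside  ∷ S} f (there i∈S) = ≤-trans (≤-sumOver (f ∘ suc) i∈S) (m≤n+m _ _)

sumOver≤∣S∣* : ∀ (S : Subset n) {f K} → (∀ {i} → i ∈ S → f i ≤ K) → sumOver S f ≤ ∣ S ∣ * K
sumOver≤∣S∣* []            f≤K = z≤n
sumOver≤∣S∣* (outside ∷ S) f≤K = sumOver≤∣S∣* S (f≤K ∘ there)
sumOver≤∣S∣* (inside  ∷ S) f≤K = +-mono-≤ (f≤K here) (sumOver≤∣S∣* S (f≤K ∘ there))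

module _ {A : Set} {P : Fin n → A → Set} (P? : ∀ i → Decidable (P i)) where

  length≤sumOver-filter : ∀ (S : Subset n) xs → (∀ {x} → x List.∈ xs → ∃ λ i → i ∈ S × P i x) →
                          length xs ≤ sumOver S (λ i → length (filter (P? i) xs))
  length≤sumOver-filter S []       covered = z≤n
  length≤sumOver-filter S (x ∷ xs) covered = begin
    suc (length xs)
      ≤⟨ +-mono-≤ x-counted (length≤sumOver-filter S xs (covered ∘ there)) ⟩
    sumOver S (λ j → length (filter (P? j) [ x ])) + sumOver S (λ j → length (filter (P? j) xs))
      ≡⟨ sumOver-+ S _ _ ⟨
    sumOver S (λ j → length (filter (P? j) [ x ]) + length (filter (P? j) xs))
      ≡⟨ sumOver-cong S length-filter-∷ ⟨
    sumOver S (λ j → length (filter (P? j) (x ∷ xs)))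
      ∎
    where
    open ≤-Reasoning
    x-counted : 1 ≤ sumOver S (λ j → length (filter (P? j) [ x ]))
    x-counted with covered (here refl)
    ... | i , i∈S , Pix =
      ≤-trans (filter-some (P? i) (here Pix)) (≤-sumOver (λ j → length (filter (P? j) [ x ])) i∈S)
    length-filter-∷ : ∀ j →
      length (filter (P? j) (x ∷ xs)) ≡ length (filter (P? j) [ x ]) + length (filter (P? j) xs)
    length-filter-∷ j = trans (cong length (filter-++ (P? j) [ x ] xs)) (length-++ (filter (P? j) [ x ]))

  length≤∣S∣* : ∀ (S : Subset n) xs {K} → (∀ {x} → x List.∈ xs → ∃ λ i → i ∈ S × P i x) →
                (∀ {i} → i ∈ S → length (filter (P? i) xs) ≤ K) → length xs ≤ ∣ S ∣ * K
  length≤∣S∣* S xs covered bounded =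
    ≤-trans (length≤sumOver-filter S xs covered) (sumOver≤∣S∣* S bounded)

lookup-removeAt : ∀ {A : Set} (xs : Vec A (suc n)) x j → lookup (removeAt xs x) j ≡ lookup xs (punchIn x j)
lookup-removeAt xs x j = begin
  lookup (removeAt xs x) j
    ≡⟨ insertAt-punchIn (removeAt xs x) x (lookup xs x) j ⟨
  lookup (insertAt (removeAt xs x) x (lookup xs x)) (punchIn x j)
    ≡⟨ cong (λ ys → lookup ys (punchIn x j)) (insertAt-removeAt xs x) ⟩
  lookup xs (punchIn x j)
    ∎
  where open ≡-Reasoning

module _ {S : Subset (suc n)} {x : Fin (suc n)} {j : Fin n} where

  ∈-removeAt⁺ : punchIn x j ∈ S → j ∈ removeAt S x
  ∈-removeAt⁺ p = lookup⇒[]= j _ (trans (lookup-removeAt S x j) ([]=⇒lookup p))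

  ∈-removeAt⁻ : j ∈ removeAt S x → punchIn x j ∈ S
  ∈-removeAt⁻ p = lookup⇒[]= _ S (trans (sym (lookup-removeAt S x j)) ([]=⇒lookup p))

∣p∣≡1+∣removeAt∣ : ∀ {S : Subset (suc n)} {x} → x ∈ S → ∣ S ∣ ≡ suc ∣ removeAt S x ∣
∣p∣≡1+∣removeAt∣ here = refl
∣p∣≡1+∣removeAt∣ {S = inside  ∷ _ ∷ _} (there x∈S) = cong suc (∣p∣≡1+∣removeAt∣ x∈S)
∣p∣≡1+∣removeAt∣ {S = outside ∷ _ ∷ _} (there x∈S) = ∣p∣≡1+∣removeAt∣ x∈S

∣removeAt∣≡ : ∀ {S : Subset (suc n)} {x k} → x ∈ S → ∣ S ∣ ≡ suc k → ∣ removeAt S x ∣ ≡ k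
∣removeAt∣≡ x∈S ∣S∣≡1+k = suc-injective (trans (sym (∣p∣≡1+∣removeAt∣ x∈S)) ∣S∣≡1+k)

∣p∣≡1+k⇒Nonempty : ∀ {S : Subset n} {k} → ∣ S ∣ ≡ suc k → Nonempty S
∣p∣≡1+k⇒Nonempty {S = inside  ∷ S} _ = zero , here
∣p∣≡1+k⇒Nonempty {S = outside ∷ S} ∣S∣≡1+k with ∣p∣≡1+k⇒Nonempty ∣S∣≡1+k
... | i , i∈S = suc i , there i∈S

removeAt-unique : ∀ x {L : List (Subset (suc n))} → All (x ∈_) L → Unique L →
                  Unique (map (λ S → removeAt S x) L)
removeAt-unique x {L} x∈L uniq = Unique.map⁻ (subst Unique (sym reinsert) uniq)
  where
  reinsert : map (λ S → insertAt S x inside) (map (λ S → removeAt S x) L) ≡ L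
  reinsert = trans (sym (map-∘ L)) (map-id-local (All.map reinsert-∈ x∈L))
    where
    reinsert-∈ : ∀ {S} → x ∈ S → insertAt (removeAt S x) x inside ≡ S
    reinsert-∈ {S} x∈S =
      subst (λ b → insertAt (removeAt S x) x b ≡ S) ([]=⇒lookup x∈S) (insertAt-removeAt S x)

Adj-sym : ∀ (G : Graph n) {i j} → Adj G i j → Adj G j i
Adj-sym G {i} {j} ij = trans (symm G j i) ij

deleteVertex : Graph (suc m) → Fin (suc m) → Graph m
deleteVertex H x = record
  { adj    = λ i j → adj H (punchIn x i) (punchIn x j)
  ; symm   = λ i j → symm H (punchIn x i) (punchIn x j)
  ; irrefl = λ i → irrefl H (punchIn x i)
  }

deleteVertex-triangleFree : ∀ (H : Graph (suc m)) x → TriangleFree H →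
                            TriangleFree (deleteVertex H x)
deleteVertex-triangleFree H x tf i j k = tf (punchIn x i) (punchIn x j) (punchIn x k)

module _ (H : Graph (suc m)) {S : Subset (suc m)} {x : Fin (suc m)}
         (mis : MaximalIndependent H S) (x∈S : x ∈ S) where

  removeAt-independent : Independent (deleteVertex H x) (removeAt S x)
  removeAt-independent i j i∈ j∈ = proj₁ mis _ _ (∈-removeAt⁻ i∈) (∈-removeAt⁻ j∈)

  removeAt-nonadjacent : ∀ {v} → v ∈ removeAt S x → adj H x (punchIn x v) ≡ false
  removeAt-nonadjacent v∈ = ¬-not (proj₁ mis _ _ x∈S (∈-removeAt⁻ v∈))

  removeAt-dominating : ∀ v → v ∉ removeAt S x → adj H x (punchIn x v) ≡ false →
                        ∃ λ w → w ∈ removeAt S x × Adj (deleteVertex H x) v w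
  removeAt-dominating v v∉ xv with proj₂ mis (punchIn x v) (v∉ ∘ ∈-removeAt⁺)
  ... | w , w∈S , vw =
    punchOut x≢w , ∈-removeAt⁺ (subst (_∈ S) (sym x↦w) w∈S) , subst (Adj H (punchIn x v)) (sym x↦w) vw
    where
    x≢w : x ≢ w
    x≢w refl with trans (sym xv) (Adj-sym H vw)
    ... | ()
    x↦w : punchIn x (punchOut x≢w) ≡ w
    x↦w = punchIn-punchOut x≢w

true-or-false : ∀ b → b ≡ true ⊎ b ≡ false
true-or-false true  = inj₁ refl
true-or-false false = inj₂ refl

module Rewire (G : Graph m) (N : Fin m → Bool) (u : Fin m) where

  rewiredAdj : Fin m → Fin m → Bool
  rewiredAdj i j with N i | N j
  ... | true  | true  = false
  ... | true  | false = does (j ≟ u)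
  ... | false | true  = does (i ≟ u)
  ... | false | false = adj G i j

  rewiredAdj-symm : ∀ i j → rewiredAdj i j ≡ rewiredAdj j i
  rewiredAdj-symm i j with N i | N j
  ... | true  | true  = refl
  ... | true  | false = refl
  ... | false | true  = refl
  ... | false | false = symm G i j

  rewiredAdj-irrefl : ∀ i → rewiredAdj i i ≡ false
  rewiredAdj-irrefl i with N i
  ... | true  = refl
  ... | false = irrefl G i

  rewired : Graph m
  rewired = record { adj = rewiredAdj ; symm = rewiredAdj-symm ; irrefl = rewiredAdj-irrefl }

  rewired-outside : ∀ {i j} → N i ≡ false → N j ≡ false → adj rewired i j ≡ adj G i j
  rewired-outside {i} {j} Ni Nj with N i | N j
  rewired-outside refl refl | false | false = refl

  rewired-inside : ∀ {i j} → N i ≡ true → Adj rewired i j → j ≡ u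
  rewired-inside {i} {j} Ni ij with N i | N j
  rewired-inside Ni () | true  | true
  rewired-inside () ij | false | _
  rewired-inside {j = j} Ni ij | true  | false with j ≟ u
  ... | yes j≡u = j≡u
  rewired-inside Ni () | true  | false | no _

  rewired-star : ∀ {v} → N v ≡ true → N u ≡ false → Adj rewired v u
  rewired-star {v} Nv Nu with N v | N u
  rewired-star Nv Nu | true  | false = dec-true (u ≟ u) refl
  rewired-star () Nu | false | _
  rewired-star Nv () | true  | true

  no-loop : ∀ {j k} → j ≡ u → k ≡ u → ¬ Adj rewired j k
  no-loop refl refl uu with trans (sym uu) (irrefl rewired u)
  ... | ()

  rewired-triangleFree : TriangleFree G → TriangleFree rewired
  rewired-triangleFree tf i j k (ij , jk , ik)
    with true-or-false (N i) | true-or-false (N j) | true-or-false (N k)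
  ... | inj₁ Ni | _       | _       = no-loop (rewired-inside Ni ij) (rewired-inside Ni ik) jk
  ... | inj₂ _  | inj₁ Nj | _       = no-loop (rewired-inside Nj (Adj-sym rewired ij)) (rewired-inside Nj jk) ik
  ... | inj₂ _  | inj₂ _  | inj₁ Nk =
    no-loop (rewired-inside Nk (Adj-sym rewired ik)) (rewired-inside Nk (Adj-sym rewired jk)) ij
  ... | inj₂ Ni | inj₂ Nj | inj₂ Nk =
    tf i j k (toG Ni Nj ij , toG Nj Nk jk , toG Ni Nk ik)
    where
    toG : ∀ {a b} → N a ≡ false → N b ≡ false → Adj rewired a b → Adj G a b
    toG Na Nb ab = trans (sym (rewired-outside Na Nb)) ab

  rewired-maximalIndependent : ∀ {S} → Independent G S → (∀ {v} → v ∈ S → N v ≡ false) → u ∈ S →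
                               (∀ v → v ∉ S → N v ≡ false → ∃ λ w → w ∈ S × Adj G v w) →
                               MaximalIndependent rewired S
  rewired-maximalIndependent {S} indep S∩N≡∅ u∈S dominating = indep′ , dominating′
    where
    indep′ : Independent rewired S
    indep′ i j i∈S j∈S ij =
      indep i j i∈S j∈S (trans (sym (rewired-outside (S∩N≡∅ i∈S) (S∩N≡∅ j∈S))) ij)
    dominating′ : ∀ v → v ∉ S → ∃ λ w → w ∈ S × Adj rewired v w
    dominating′ v v∉S with true-or-false (N v)
    ... | inj₁ Nv = u , u∈S , rewired-star Nv (S∩N≡∅ u∈S)
    ... | inj₂ Nv with dominating v v∉S Nv
    ...   | w , w∈S , vw = w , w∈S , trans (rewired-outside Nv (S∩N≡∅ w∈S)) vw

linkGraph : Graph (suc m) → Fin (suc m) → Fin m → Graph m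
linkGraph H x u = Rewire.rewired (deleteVertex H x) (λ i → adj H x (punchIn x i)) u

linkGraph-triangleFree : ∀ (H : Graph (suc m)) x u → TriangleFree H → TriangleFree (linkGraph H x u)
linkGraph-triangleFree H x u tf =
  Rewire.rewired-triangleFree (deleteVertex H x) (λ i → adj H x (punchIn x i)) u
    (deleteVertex-triangleFree H x tf)

linkGraph-maximalIndependent : ∀ (H : Graph (suc m)) {S x u} →
                               MaximalIndependent H S → x ∈ S → punchIn x u ∈ S →
                               MaximalIndependent (linkGraph H x u) (removeAt S x)
linkGraph-maximalIndependent H {x = x} {u} mis x∈S u∈S =
  Rewire.rewired-maximalIndependent (deleteVertex H x) (λ i → adj H x (punchIn x i)) u
    (removeAt-independent H mis x∈S) (removeAt-nonadjacent H mis x∈S)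
    (∈-removeAt⁺ u∈S) (removeAt-dominating H mis x∈S)

module Link (sys : System (suc t) (suc m)) (x : Fin (suc m)) (u : Fin m) where
  open System sys

  through : List (Subset (suc m))
  through = filter (punchIn x u ∈?_) (filter (x ∈?_) F)

  ∈-through⁻ : ∀ {S} → S List.∈ through → S List.∈ F × x ∈ S × punchIn x u ∈ S
  ∈-through⁻ S∈ with ∈-filter⁻ (punchIn x u ∈?_) S∈
  ... | S∈Fx , u∈S with ∈-filter⁻ (x ∈?_) S∈Fx
  ...   | S∈F , x∈S = S∈F , x∈S , u∈S

  family : List (Subset m)
  family = map (λ S → removeAt S x) through

  ∈-family⁻ : ∀ {S′} → S′ List.∈ family →
                  ∃ λ S → S List.∈ F × x ∈ S × punchIn x u ∈ S × S′ ≡ removeAt S x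
  ∈-family⁻ S′∈ with ∈-map⁻ (λ S → removeAt S x) S′∈
  ... | S , S∈ , S′≡ with ∈-through⁻ S∈
  ...   | S∈F , x∈S , u∈S = S , S∈F , x∈S , u∈S , S′≡

  system : System t m
  system = record
    { H            = linkGraph H x u
    ; triFree      = linkGraph-triangleFree H x u triFree
    ; F            = family
    ; noRep        = removeAt-unique x (All.tabulate (proj₁ ∘ proj₂ ∘ ∈-through⁻))
                       (Unique.filter⁺ _ (Unique.filter⁺ _ noRep))
    ; size         = size′
    ; maxInd       = maxInd′
    ; intersecting = λ _ _ S∈ T∈ _ → u , u∈ S∈ , u∈ T∈
    }
    where
    size′ : ∀ S′ → S′ List.∈ family → ∣ S′ ∣ ≡ t
    size′ _ S′∈ with ∈-family⁻ S′∈
    ... | S , S∈F , x∈S , _ , refl = ∣removeAt∣≡ x∈S (size S S∈F)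
    maxInd′ : ∀ S′ → S′ List.∈ family → MaximalIndependent (linkGraph H x u) S′
    maxInd′ _ S′∈ with ∈-family⁻ S′∈
    ... | S , S∈F , x∈S , u∈S , refl = linkGraph-maximalIndependent H (maxInd S S∈F) x∈S u∈S
    u∈ : ∀ {S′} → S′ List.∈ family → u ∈ S′
    u∈ S′∈ with ∈-family⁻ S′∈
    ... | S , _ , _ , u∈S , refl = ∈-removeAt⁺ u∈S

  length-family : length family ≡ length through
  length-family = length-map _ through

degree≤ : ∀ {a} → (∀ (s : System (suc t) m) → length (System.F s) ≤ a) →
          (sys : System (suc (suc t)) (suc m)) (x : Fin (suc m)) →
          length (filter (x ∈?_) (System.F sys)) ≤ m * a
degree≤ {m = m} {a = a} maxA sys x = begin
  length Fx     ≤⟨ length≤∣S∣* (λ u T → punchIn x u ∈? T) ⊤ Fx covered bounded ⟩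
  ∣ ⊤ {m} ∣ * a ≡⟨ cong (_* a) (∣⊤∣≡n m) ⟩
  m * a         ∎
  where
  open ≤-Reasoning
  open System sys
  Fx = filter (x ∈?_) F
  covered : ∀ {T} → T List.∈ Fx → ∃ λ u → u ∈ ⊤ × punchIn x u ∈ T
  covered T∈ with ∈-filter⁻ (x ∈?_) T∈
  ... | T∈F , x∈T with ∣p∣≡1+k⇒Nonempty (∣removeAt∣≡ x∈T (size _ T∈F))
  ...   | u , u∈ = u , ∈⊤ , ∈-removeAt⁻ u∈
  bounded : ∀ {u} → u ∈ ⊤ → length (filter (λ T → punchIn x u ∈? T) Fx) ≤ a
  bounded {u} _ = subst (_≤ a) (Link.length-family sys x u) (maxA (Link.system sys x u))

intersecting-length≤ : ∀ {K} (F : List (Subset n)) → (∀ S → S List.∈ F → ∣ S ∣ ≡ suc t) →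
  (∀ S T → S List.∈ F → T List.∈ F → S ≢ T → ∃ λ x → x ∈ S × x ∈ T) →
  (∀ x → length (filter (x ∈?_) F) ≤ K) → length F ≤ suc t * K
intersecting-length≤ [] _ _ _ = z≤n
intersecting-length≤ {t = t} {K = K} F@(S₀ ∷ _) size intersecting degree≤K = begin
  length F     ≤⟨ length≤∣S∣* (λ x T → x ∈? T) S₀ F covered (λ {x} _ → degree≤K x) ⟩
  ∣ S₀ ∣ * K   ≡⟨ cong (_* K) (size S₀ (here refl)) ⟩
  suc t * K    ∎
  where
  open ≤-Reasoning
  covered : ∀ {T} → T List.∈ F → ∃ λ x → x ∈ S₀ × x ∈ T
  covered {T} T∈F with ≡-dec Bool._≟_ S₀ T
  ... | no S₀≢T = intersecting S₀ T (here refl) T∈F S₀≢T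
  ... | yes refl with ∣p∣≡1+k⇒Nonempty (size S₀ (here refl))
  ...   | x , x∈S₀ = x , x∈S₀ , x∈S₀

addIsolatedVertex : Graph m → Graph (suc m)
addIsolatedVertex {m} H = record { adj = adj′ ; symm = symm′ ; irrefl = irrefl′ }
  where
  adj′ : Fin (suc m) → Fin (suc m) → Bool
  adj′ (suc i) (suc j) = adj H i j
  adj′ _       _       = false
  symm′ : ∀ i j → adj′ i j ≡ adj′ j i
  symm′ zero    zero    = refl
  symm′ zero    (suc j) = refl
  symm′ (suc i) zero    = refl
  symm′ (suc i) (suc j) = symm H i j
  irrefl′ : ∀ i → adj′ i i ≡ false
  irrefl′ zero    = refl
  irrefl′ (suc i) = irrefl H i

addIsolatedVertex-triangleFree : ∀ (H : Graph m) → TriangleFree H → TriangleFree (addIsolatedVertex H)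
addIsolatedVertex-triangleFree H tf (suc i) (suc j) (suc k) = tf i j k
addIsolatedVertex-triangleFree H tf zero    _       _       (() , _ , _)
addIsolatedVertex-triangleFree H tf (suc i) zero    _       (() , _ , _)
addIsolatedVertex-triangleFree H tf (suc i) (suc j) zero    (_ , () , _)

inside∷-maximalIndependent : ∀ (H : Graph m) {S} → MaximalIndependent H S →
                             MaximalIndependent (addIsolatedVertex H) (inside ∷ S)
inside∷-maximalIndependent H (indep , dominating) = indep′ , dominating′
  where
  indep′ : Independent (addIsolatedVertex H) (inside ∷ _)
  indep′ (suc i) (suc j) (there i∈S) (there j∈S) = indep i j i∈S j∈S
  indep′ zero    _       _           _           ()
  indep′ (suc i) zero    _           _           ()
  dominating′ : ∀ v → v ∉ inside ∷ _ → ∃ λ w → w ∈ inside ∷ _ × Adj (addIsolatedVertex H) v w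
  dominating′ zero    v∉ = ⊥-elim (v∉ here)
  dominating′ (suc v) v∉ with dominating v (v∉ ∘ there)
  ... | w , w∈S , vw = suc w , there w∈S , vw

addIsolatedVertex-system : System t m → System (suc t) (suc m)
addIsolatedVertex-system {t} {m} sys = record
  { H            = addIsolatedVertex H
  ; triFree      = addIsolatedVertex-triangleFree H triFree
  ; F            = map (inside ∷_) F
  ; noRep        = Unique.map⁺ ∷-injectiveʳ noRep
  ; size         = size′
  ; maxInd       = maxInd′
  ; intersecting = λ _ _ S∈ T∈ _ → zero , zero∈ S∈ , zero∈ T∈
  }
  where
  open System sys
  size′ : ∀ S′ → S′ List.∈ map (inside ∷_) F → ∣ S′ ∣ ≡ suc t
  size′ _ S′∈ with ∈-map⁻ (inside ∷_) S′∈
  ... | S , S∈F , refl = cong suc (size S S∈F)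
  maxInd′ : ∀ S′ → S′ List.∈ map (inside ∷_) F → MaximalIndependent (addIsolatedVertex H) S′
  maxInd′ _ S′∈ with ∈-map⁻ (inside ∷_) S′∈
  ... | S , S∈F , refl = inside∷-maximalIndependent H (maxInd S S∈F)
  zero∈ : ∀ {S′} → S′ List.∈ map (inside ∷_) F → zero ∈ S′
  zero∈ S′∈ with ∈-map⁻ (inside ∷_) S′∈
  ... | S , S∈F , refl = here

s3-monotone : ∀ {a b} → IsS3 t m a → IsS3 (suc t) (suc m) b → a ≤ b
s3-monotone ((sys , refl) , _) (_ , maxB) =
  subst (_≤ _) (length-map (inside ∷_) (System.F sys)) (maxB (addIsolatedVertex-system sys))

s3-step-bound : ∀ {a b} → IsS3 (suc t) m a → IsS3 (suc (suc t)) (suc m) b →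
                b ≤ suc (suc t) * (m * a)
s3-step-bound (_ , maxA) ((sys , refl) , _) =
  intersecting-length≤ F size intersecting (degree≤ maxA sys)
  where open System sys

theorem12 : ∀ (t : ℕ) → 1 ≤ t →
    ∃ λ (C₁ : ℕ) → ∃ λ (C₂ : ℕ) → ∃ λ (M : ℕ) →
      ∀ (m a b : ℕ) → M ≤ m →
        IsS3 t m a → IsS3 (suc t) (suc m) b →
        (a ≤ C₁ * b) × (b ≤ C₂ * (m * a))
theorem12 (suc t) _ = 1 , suc (suc t) , 0 , λ m a b _ sA sB →
  ≤-trans (s3-monotone sA sB) (≤-reflexive (sym (*-identityˡ b))) , s3-step-bound sA sB
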